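{- Let $\alpha=\sqrt{3}+\sqrt{2}$, and for every odd integer $k$ (positive or negative) let $P_k,Q_k\in\mathbb{Z}$ be the unique integers with $\alpha^k=P_k\sqrt{3}+Q_k\sqrt{2}$. Let $n$ be an odd integer. If $P_n=x^2$ for some integer $x$, then $n\equiv 1,\,-1,\,3,$ or $-3 \pmod{840}$.
   Context: For odd $k$, the pairs $(P_k,Q_k)$ with $k\ge 1$ are exactly the positive integer solutions of $3x^2-2y^2=1$. Since $\alpha^{ -1}=\sqrt{3}-\sqrt{2}$, one has $P_{ -k}=P_k$ and $Q_{ -k}=-Q_k$ for odd $k$. -}

module Defs where

open import Data.Nat using (ℕ; zero; suc)
open import Data.Integer using (ℤ; +_; -[1+_]; _+_; _*_; -_)

-- Elements of the ring ℤ[√2,√3] written as  a + b·√3 + c·√2 + d·√6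
-- (1, √3, √2, √6 are linearly independent over ℚ, so coefficients are unique).
record Z23 : Set where
  constructor mk
  field
    c1  : ℤ
    c√3 : ℤ
    c√2 : ℤ
    c√6 : ℤ
open Z23 public

infixl 7 _·_
_·_ : Z23 → Z23 → Z23
mk a b c d · mk e f g h =
  mk (a * e + + 3 * (b * f) + + 2 * (c * g) + + 6 * (d * h))
     (a * f + b * e + + 2 * (c * h) + + 2 * (d * g))
     (a * g + c * e + + 3 * (b * h) + + 3 * (d * f))
     (a * h + d * e + b * g + c * f)

one : Z23
one = mk (+ 1) (+ 0) (+ 0) (+ 0)

α : Z23
α = mk (+ 0) (+ 1) (+ 1) (+ 0)

α⁻¹ : Z23
α⁻¹ = mk (+ 0) (+ 1) (- (+ 1)) (+ 0)

powℕ : Z23 → ℕ → Z23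
powℕ x zero    = one
powℕ x (suc n) = powℕ x n · x

αpow : ℤ → Z23
αpow (+ n)     = powℕ α n
αpow -[1+ n ]  = powℕ α⁻¹ (suc n)

P : ℤ → ℤ
P k = c√3 (αpow k)

Q : ℤ → ℤ
Q k = c√2 (αpow k)

-- Both α and α⁻¹ = √3 − √2 are exchanged by the automorphism √2 ↦ −√2 of ℤ[√2,√3], which fixes
-- the √3-coordinate, so P₋ₙ = Pₙ and it suffices to treat n = 2k + 1 ≥ 1. Multiplying by
-- α² = 5 + 2√6 sends P√3 + Q√2 to (5P + 4Q)√3 + (6P + 5Q)√2, so (P_{2k+1}, Q_{2k+1}) is the orbit
-- of (1, 1) under a linear map. Modulo each of the primes 3, 13, 29, 41, 43, 59, 71, 211, 241, 337
-- this orbit is periodic with a period dividing 840. For every residue of k mod 840 other than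
-- those giving n ≡ ±1, ±3 (mod 840), one of these primes sees P_{2k+1} as a quadratic non-residue,
-- so P_{2k+1} is not a square.
module Submission where

open import Defs
open import Data.Integer using (ℤ; +_; _*_; _-_; _+_)
open import Data.Integer.Divisibility using (_∣_; divides)
open import Data.Sum using (_⊎_)
open import Relation.Nullary using (¬_)
open import Relation.Binary.PropositionalEquality using (_≡_)

open import Data.Integer using (-[1+_]; -_; ∣_∣)
open import Data.Integer.Properties using (pos-+; pos-*; abs-*; ∣-i∣≡∣i∣)
open import Data.Integer.Tactic.RingSolver using (solve-∀)
import Data.Integer.Divisibility.Signed as Signed
open import Data.Nat as ℕ using (ℕ; zero; suc; _<_; NonZero; _≟_)
open import Data.Nat.DivMod using (_%_; _/_; m≡m%n+[m/n]*n; m%n<n; m%n%n≡m%n; %-distribˡ-+; %-distribˡ-*; m∣n⇒o%n%m≡o%m)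
open import Data.Nat.Divisibility using (_∣?_; m%n≡0⇒n∣m) renaming (_∣_ to _∣ℕ_)
open import Data.Nat.GeneralisedArithmetic using (fold)
open import Data.Nat.Properties using (allUpTo?)
open import Data.Product using (_×_; _,_; proj₁)
open import Data.Product.Properties using (≡-dec)
open import Data.Sum using (inj₁; inj₂)
open import Data.Empty using (⊥-elim)
open import Data.List using (List; []; _∷_)
open import Data.List.Relation.Unary.All using (All; all?; lookupAny)
open import Data.List.Relation.Unary.Any as Any using (Any; any?; here; there)
open import Data.List.Membership.Propositional using (_∈_)
open import Data.List.Membership.DecPropositional _≟_ using (_∈?_)
open import Relation.Nullary using (Dec; ¬?)
open import Relation.Nullary.Decidable using (from-yes; _×-dec_; _⊎-dec_)
open import Relation.Binary.PropositionalEquality using (_≢_; refl; sym; trans; cong; cong₂; subst; module ≡-Reasoning)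

open ≡-Reasoning

Z23-ext : ∀ {x y} → c1 x ≡ c1 y → c√3 x ≡ c√3 y → c√2 x ≡ c√2 y → c√6 x ≡ c√6 y → x ≡ y
Z23-ext refl refl refl refl = refl

conj : Z23 → Z23
conj (mk a b c d) = mk a b (- c) (- d)

-- solve-∀ does not unfold _·_, so each component is spelled out as _·_ computes it.
conj-· : ∀ x y → conj (x · y) ≡ conj x · conj y
conj-· (mk a b c d) (mk e f g h) = Z23-ext (c1-eq a b c d e f g h) (c√3-eq a b c d e f g h)
                                           (c√2-eq a b c d e f g h) (c√6-eq a b c d e f g h)
  where
  c1-eq : ∀ a b c d e f g h →
    a * e + + 3 * (b * f) + + 2 * (c * g) + + 6 * (d * h) ≡
    a * e + + 3 * (b * f) + + 2 * ((- c) * (- g)) + + 6 * ((- d) * (- h))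
  c1-eq = solve-∀
  c√3-eq : ∀ a b c d e f g h →
    a * f + b * e + + 2 * (c * h) + + 2 * (d * g) ≡
    a * f + b * e + + 2 * ((- c) * (- h)) + + 2 * ((- d) * (- g))
  c√3-eq = solve-∀
  c√2-eq : ∀ a b c d e f g h →
    - (a * g + c * e + + 3 * (b * h) + + 3 * (d * f)) ≡
    a * (- g) + (- c) * e + + 3 * (b * (- h)) + + 3 * ((- d) * f)
  c√2-eq = solve-∀
  c√6-eq : ∀ a b c d e f g h →
    - (a * h + d * e + b * g + c * f) ≡
    a * (- h) + (- d) * e + b * (- g) + (- c) * f
  c√6-eq = solve-∀

conj-powℕ : ∀ x n → conj (powℕ x n) ≡ powℕ (conj x) n
conj-powℕ x zero    = refl
conj-powℕ x (suc n) = begin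
  conj (powℕ x n · x)       ≡⟨ conj-· (powℕ x n) x ⟩
  conj (powℕ x n) · conj x  ≡⟨ cong (_· conj x) (conj-powℕ x n) ⟩
  powℕ (conj x) n · conj x  ∎

-- conj α is α⁻¹ on the nose, and conj does not touch the √3-coordinate.
P-neg : ∀ N → P (- (+ N)) ≡ P (+ N)
P-neg zero    = refl
P-neg (suc m) = sym (cong c√3 (conj-powℕ α (suc m)))

mk·α : ∀ a b c d → mk a b c d · α ≡ mk (+ 3 * b + + 2 * c) (a + + 2 * d) (a + + 3 * d) (b + c)
mk·α a b c d = Z23-ext (c1-eq a b c d) (c√3-eq a b c d) (c√2-eq a b c d) (c√6-eq a b c d)
  where
  c1-eq : ∀ a b c d → a * + 0 + + 3 * (b * + 1) + + 2 * (c * + 1) + + 6 * (d * + 0) ≡ + 3 * b + + 2 * c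
  c1-eq = solve-∀
  c√3-eq : ∀ a b c d → a * + 1 + b * + 0 + + 2 * (c * + 0) + + 2 * (d * + 1) ≡ a + + 2 * d
  c√3-eq = solve-∀
  c√2-eq : ∀ a b c d → a * + 1 + c * + 0 + + 3 * (b * + 0) + + 3 * (d * + 1) ≡ a + + 3 * d
  c√2-eq = solve-∀
  c√6-eq : ∀ a b c d → a * + 0 + d * + 0 + b * + 1 + c * + 1 ≡ b + c
  c√6-eq = solve-∀

step : ℕ × ℕ → ℕ × ℕ
step (p , q) = 5 ℕ.* p ℕ.+ 4 ℕ.* q , 6 ℕ.* p ℕ.+ 5 ℕ.* q

coeffs : ℕ → ℕ × ℕ
coeffs = fold (1 , 1) step

embed : ℕ × ℕ → Z23
embed (p , q) = mk (+ 0) (+ p) (+ q) (+ 0)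

pos-lincomb : ∀ a b p q → + (a ℕ.* p ℕ.+ b ℕ.* q) ≡ + a * + p + + b * + q
pos-lincomb a b p q = trans (pos-+ (a ℕ.* p) (b ℕ.* q)) (cong₂ _+_ (pos-* a p) (pos-* b q))

embed-·α² : ∀ x → embed x · α · α ≡ embed (step x)
embed-·α² (p , q) = begin
  mk (+ 0) (+ p) (+ q) (+ 0) · α · α        ≡⟨ cong (_· α) (mk·α (+ 0) (+ p) (+ q) (+ 0)) ⟩
  mk (+ 3 * + p + + 2 * + q) (+ 0) (+ 0) (+ p + + q) · α
                                            ≡⟨ mk·α (+ 3 * + p + + 2 * + q) (+ 0) (+ 0) (+ p + + q) ⟩
  mk (+ 0) (+ 3 * + p + + 2 * + q + + 2 * (+ p + + q)) (+ 3 * + p + + 2 * + q + + 3 * (+ p + + q)) (+ 0)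
                                            ≡⟨ Z23-ext refl (c√3-eq (+ p) (+ q)) (c√2-eq (+ p) (+ q)) refl ⟩
  mk (+ 0) (+ 5 * + p + + 4 * + q) (+ 6 * + p + + 5 * + q) (+ 0)
                                            ≡⟨ sym (Z23-ext refl (pos-lincomb 5 4 p q) (pos-lincomb 6 5 p q) refl) ⟩
  embed (step (p , q))                      ∎
  where
  c√3-eq : ∀ p q → + 3 * p + + 2 * q + + 2 * (p + q) ≡ + 5 * p + + 4 * q
  c√3-eq = solve-∀
  c√2-eq : ∀ p q → + 3 * p + + 2 * q + + 3 * (p + q) ≡ + 6 * p + + 5 * q
  c√2-eq = solve-∀

powℕ-α-odd : ∀ k → powℕ α (1 ℕ.+ k ℕ.* 2) ≡ embed (coeffs k)
powℕ-α-odd zero    = refl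
powℕ-α-odd (suc k) = trans (cong (λ y → y · α · α) (powℕ-α-odd k)) (embed-·α² (coeffs k))

P-odd : ∀ k → P (+ (1 ℕ.+ k ℕ.* 2)) ≡ + proj₁ (coeffs k)
P-odd k = cong c√3 (powℕ-α-odd k)

module _ {A : Set} where

  fold-+ : ∀ (x : A) f m n → fold x f (m ℕ.+ n) ≡ fold (fold x f n) f m
  fold-+ x f zero    n = refl
  fold-+ x f (suc m) n = cong f (fold-+ x f m n)

  fold-commute : ∀ {B : Set} {g : A → B} {f : A → A} {f′ : B → B} →
                 (∀ y → g (f y) ≡ f′ (g y)) → ∀ x n → g (fold x f n) ≡ fold (g x) f′ n
  fold-commute                   comm x zero    = refl
  fold-commute {f = f} {f′ = f′} comm x (suc n) = trans (comm (fold x f n)) (cong f′ (fold-commute comm x n))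

  fold-periodic : ∀ (x : A) f L .{{_ : NonZero L}} → fold x f L ≡ x → ∀ n → fold x f n ≡ fold x f (n % L)
  fold-periodic x f L x-periodic n = begin
    fold x f n                                 ≡⟨ cong (fold x f) (m≡m%n+[m/n]*n n L) ⟩
    fold x f (n % L ℕ.+ n / L ℕ.* L)           ≡⟨ fold-+ x f (n % L) (n / L ℕ.* L) ⟩
    fold (fold x f (n / L ℕ.* L)) f (n % L)    ≡⟨ cong (λ y → fold y f (n % L)) (multiple (n / L)) ⟩
    fold x f (n % L)                           ∎
    where
    multiple : ∀ q → fold x f (q ℕ.* L) ≡ x
    multiple zero    = refl
    multiple (suc q) = trans (fold-+ x f L (q ℕ.* L)) (trans (cong (λ y → fold y f L) (multiple q)) x-periodic)

module _ {m : ℕ} .{{_ : NonZero m}} where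

  %-cong-+ : ∀ {x x′ y y′} → x % m ≡ x′ % m → y % m ≡ y′ % m → (x ℕ.+ y) % m ≡ (x′ ℕ.+ y′) % m
  %-cong-+ {x} {x′} {y} {y′} x≡x′ y≡y′ = begin
    (x ℕ.+ y) % m              ≡⟨ %-distribˡ-+ x y m ⟩
    (x % m ℕ.+ y % m) % m      ≡⟨ cong₂ (λ u v → (u ℕ.+ v) % m) x≡x′ y≡y′ ⟩
    (x′ % m ℕ.+ y′ % m) % m    ≡⟨ sym (%-distribˡ-+ x′ y′ m) ⟩
    (x′ ℕ.+ y′) % m            ∎

  %-cong-* : ∀ {x x′ y y′} → x % m ≡ x′ % m → y % m ≡ y′ % m → (x ℕ.* y) % m ≡ (x′ ℕ.* y′) % m
  %-cong-* {x} {x′} {y} {y′} x≡x′ y≡y′ = begin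
    (x ℕ.* y) % m              ≡⟨ %-distribˡ-* x y m ⟩
    (x % m ℕ.* (y % m)) % m    ≡⟨ cong₂ (λ u v → (u ℕ.* v) % m) x≡x′ y≡y′ ⟩
    (x′ % m ℕ.* (y′ % m)) % m  ≡⟨ sym (%-distribˡ-* x′ y′ m) ⟩
    (x′ ℕ.* y′) % m            ∎

  [1+[k%m]*2]%m≡[1+k*2]%m : ∀ k → (1 ℕ.+ (k % m) ℕ.* 2) % m ≡ (1 ℕ.+ k ℕ.* 2) % m
  [1+[k%m]*2]%m≡[1+k*2]%m k = %-cong-+ {1} {1} refl (%-cong-* {k % m} {k} {2} {2} (m%n%n≡m%n k m) refl)

  reduce : ℕ × ℕ → ℕ × ℕ
  reduce (p , q) = p % m , q % m

  reduce-step : ∀ x → reduce (step x) ≡ reduce (step (reduce x))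
  reduce-step (p , q) = cong₂ _,_ (lincomb 5 4) (lincomb 6 5)
    where
    lincomb : ∀ a b → (a ℕ.* p ℕ.+ b ℕ.* q) % m ≡ (a ℕ.* (p % m) ℕ.+ b ℕ.* (q % m)) % m
    lincomb a b = %-cong-+ (%-cong-* {a} refl (sym (m%n%n≡m%n p m)))
                           (%-cong-* {b} refl (sym (m%n%n≡m%n q m)))

  coeffsMod : ℕ → ℕ × ℕ
  coeffsMod = fold (reduce (1 , 1)) (λ x → reduce (step x))

  NonResidue : ℕ → Set
  NonResidue v = ∀ {r} → r < m → (r ℕ.* r) % m ≢ v

  nonResidue? : ∀ v → Dec (NonResidue v)
  nonResidue? v = allUpTo? (λ r → ¬? ((r ℕ.* r) % m ≟ v)) m

  NonResidue⇒≢square : ∀ {v} → NonResidue v → ∀ y → (y ℕ.* y) % m ≢ v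
  NonResidue⇒≢square nonResidue y y²≡v =
    nonResidue (m%n<n y m) (trans (%-cong-* (m%n%n≡m%n y m) (m%n%n≡m%n y m)) y²≡v)

  reduce-coeffs : ∀ k → reduce (coeffs k) ≡ coeffsMod k
  reduce-coeffs = fold-commute {g = reduce} {f = step} reduce-step (1 , 1)

  non-residue-obstruction : ∀ L M .{{_ : NonZero L}} .{{_ : NonZero M}} → L ∣ℕ M →
    coeffsMod L ≡ coeffsMod 0 → ∀ k → NonResidue (proj₁ (coeffsMod ((k % M) % L))) →
    ∀ y → proj₁ (coeffs k) ≢ y ℕ.* y
  non-residue-obstruction L M L∣M L-period k nonResidue y pₖ≡y² =
    NonResidue⇒≢square nonResidue y (begin
      (y ℕ.* y) % m                          ≡⟨ cong (_% m) (sym pₖ≡y²) ⟩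
      proj₁ (reduce (coeffs k))              ≡⟨ cong proj₁ (reduce-coeffs k) ⟩
      proj₁ (coeffsMod k)                    ≡⟨ cong proj₁ (fold-periodic _ _ L L-period k) ⟩
      proj₁ (coeffsMod (k % L))              ≡⟨ cong (λ i → proj₁ (coeffsMod i)) (sym (m∣n⇒o%n%m≡o%m L M k L∣M)) ⟩
      proj₁ (coeffsMod ((k % M) % L))        ∎)

record SieveModulus : Set where
  constructor _with-period_
  field
    modulus period : ℕ
    {{modulus≢0}}  : NonZero modulus
    {{period≢0}}   : NonZero period
open SieveModulus

sieve : List SieveModulus
sieve = 3 with-period 6 ∷ 13 with-period 7 ∷ 29 with-period 28 ∷ 41 with-period 42
      ∷ 43 with-period 42 ∷ 59 with-period 30 ∷ 71 with-period 35 ∷ 211 with-period 70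
      ∷ 241 with-period 120 ∷ 337 with-period 168 ∷ []

IsPeriod : SieveModulus → Set
IsPeriod e = period e ∣ℕ 840 × coeffsMod {modulus e} (period e) ≡ coeffsMod 0

-- Both finite checks are opaque: unfolding them at their use sites makes type checking blow up.
opaque
  sieve-periods : All IsPeriod sieve
  sieve-periods = from-yes (all? isPeriod? sieve)
    where
    isPeriod? : ∀ e → Dec (IsPeriod e)
    isPeriod? e = period e ∣? 840 ×-dec ≡-dec _≟_ _≟_ _ _

Obstructed : ℕ → Set
Obstructed c = Any (λ e → NonResidue {modulus e} (proj₁ (coeffsMod (c % period e)))) sieve

allowedResidues : List ℕ
allowedResidues = 1 ∷ 3 ∷ 837 ∷ 839 ∷ []

opaque
  sieve-covers : ∀ {c} → c < 840 → (1 ℕ.+ c ℕ.* 2) % 840 ∈ allowedResidues ⊎ Obstructed c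
  sieve-covers = from-yes (allUpTo? (λ c → (1 ℕ.+ c ℕ.* 2) % 840 ∈? allowedResidues ⊎-dec obstructed? c) 840)
    where
    obstructed? : ∀ c → Dec (Obstructed c)
    obstructed? c = any? (λ e → nonResidue? _) sieve

obstructed⇒≢square : ∀ k y → Obstructed (k % 840) → proj₁ (coeffs k) ≢ y ℕ.* y
obstructed⇒≢square k y obstructed with Any.lookup obstructed | lookupAny sieve-periods obstructed
... | e | (L∣840 , L-period) , nonResidue =
  non-residue-obstruction {modulus e} (period e) 840 L∣840 L-period k nonResidue y

square-coeff⇒allowed : ∀ k y → proj₁ (coeffs k) ≡ y ℕ.* y → (1 ℕ.+ k ℕ.* 2) % 840 ∈ allowedResidues
square-coeff⇒allowed k y pₖ≡y² with sieve-covers (m%n<n k 840)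
... | inj₁ allowed    = subst (_∈ allowedResidues) ([1+[k%m]*2]%m≡[1+k*2]%m {840} k) allowed
... | inj₂ obstructed = ⊥-elim (obstructed⇒≢square k y obstructed pₖ≡y²)

Allowed : ℤ → Set
Allowed n = (+ 840 ∣ (n - + 1)) ⊎ (+ 840 ∣ (n + + 1)) ⊎ (+ 840 ∣ (n - + 3)) ⊎ (+ 840 ∣ (n + + 3))

∣n-a⇒∣-n+a : ∀ k n a → k ∣ n - a → k ∣ - n + a
∣n-a⇒∣-n+a k n a k∣n-a = subst (k ∣_) (neg-minus n a) (subst (∣ k ∣ ∣ℕ_) (sym (∣-i∣≡∣i∣ (n - a))) k∣n-a)
  where
  neg-minus : ∀ n a → - (n - a) ≡ - n + a
  neg-minus = solve-∀

∣n+a⇒∣-n-a : ∀ k n a → k ∣ n + a → k ∣ - n - a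
∣n+a⇒∣-n-a k n a k∣n+a = subst (k ∣_) (neg-plus n a) (subst (∣ k ∣ ∣ℕ_) (sym (∣-i∣≡∣i∣ (n + a))) k∣n+a)
  where
  neg-plus : ∀ n a → - (n + a) ≡ - n - a
  neg-plus = solve-∀

Allowed-neg : ∀ n → Allowed n → Allowed (- n)
Allowed-neg n (inj₁ d)               = inj₂ (inj₁ (∣n-a⇒∣-n+a (+ 840) n (+ 1) d))
Allowed-neg n (inj₂ (inj₁ d))        = inj₁ (∣n+a⇒∣-n-a (+ 840) n (+ 1) d)
Allowed-neg n (inj₂ (inj₂ (inj₁ d))) = inj₂ (inj₂ (inj₂ (∣n-a⇒∣-n+a (+ 840) n (+ 3) d)))
Allowed-neg n (inj₂ (inj₂ (inj₂ d))) = inj₂ (inj₂ (inj₁ (∣n+a⇒∣-n-a (+ 840) n (+ 3) d)))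

N%m≡r⇒m∣N-r : ∀ m .{{_ : NonZero m}} N {r} → N % m ≡ r → + m ∣ + N - + r
N%m≡r⇒m∣N-r m N refl = divides (N / m) (cong ∣_∣ (begin
  + N - + (N % m)                        ≡⟨ cong (λ t → + t - + (N % m)) (m≡m%n+[m/n]*n N m) ⟩
  + (N % m ℕ.+ N / m ℕ.* m) - + (N % m)  ≡⟨ cong (_- + (N % m)) (pos-+ (N % m) (N / m ℕ.* m)) ⟩
  + (N % m) + + (N / m ℕ.* m) - + (N % m) ≡⟨ add-sub (+ (N % m)) (+ (N / m ℕ.* m)) ⟩
  + (N / m ℕ.* m)                        ∎))
  where
  add-sub : ∀ a b → a + b - a ≡ b
  add-sub = solve-∀

∣n-a⇒∣n+[k-a] : ∀ k n a → k ∣ n - a → k ∣ n + (k - a)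
∣n-a⇒∣n+[k-a] k n a k∣n-a = subst (k ∣_) (shift n k a)
  (Signed.∣⇒∣ᵤ {k} {n - a + k} (Signed.∣m∣n⇒∣m+n (Signed.∣ᵤ⇒∣ {k} {n - a} k∣n-a) Signed.∣-refl))
  where
  shift : ∀ n k a → n - a + k ≡ n + (k - a)
  shift = solve-∀

residue⇒Allowed : ∀ N → N % 840 ∈ allowedResidues → Allowed (+ N)
residue⇒Allowed N (here r≡1)                       = inj₁ (N%m≡r⇒m∣N-r 840 N r≡1)
residue⇒Allowed N (there (here r≡3))               = inj₂ (inj₂ (inj₁ (N%m≡r⇒m∣N-r 840 N r≡3)))
residue⇒Allowed N (there (there (here r≡837)))     =
  inj₂ (inj₂ (inj₂ (∣n-a⇒∣n+[k-a] (+ 840) (+ N) (+ 837) (N%m≡r⇒m∣N-r 840 N r≡837))))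
residue⇒Allowed N (there (there (there (here r≡839)))) =
  inj₂ (inj₁ (∣n-a⇒∣n+[k-a] (+ 840) (+ N) (+ 839) (N%m≡r⇒m∣N-r 840 N r≡839)))
residue⇒Allowed N (there (there (there (there ()))))

odd⇒≡1+[n/2]*2 : ∀ N → ¬ 2 ∣ℕ N → N ≡ 1 ℕ.+ N / 2 ℕ.* 2
odd⇒≡1+[n/2]*2 N 2∤N with N % 2 in N%2≡r | m%n<n N 2
... | 0           | _               = ⊥-elim (2∤N (m%n≡0⇒n∣m N 2 N%2≡r))
... | 1           | _               = trans (m≡m%n+[m/n]*n N 2) (cong (ℕ._+ N / 2 ℕ.* 2) N%2≡r)
... | suc (suc _) | ℕ.s≤s (ℕ.s≤s ())

odd-square⇒Allowed : ∀ N → ¬ 2 ∣ℕ N → ∀ x → P (+ N) ≡ x * x → Allowed (+ N)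
odd-square⇒Allowed N 2∤N x Pₙ≡x² =
  subst (λ N′ → Allowed (+ N′)) (sym N≡1+2k) (residue⇒Allowed (1 ℕ.+ k ℕ.* 2) (square-coeff⇒allowed k ∣ x ∣ pₖ≡∣x∣²))
  where
  k : ℕ
  k = N / 2
  N≡1+2k : N ≡ 1 ℕ.+ k ℕ.* 2
  N≡1+2k = odd⇒≡1+[n/2]*2 N 2∤N
  pₖ≡∣x∣² : proj₁ (coeffs k) ≡ ∣ x ∣ ℕ.* ∣ x ∣
  pₖ≡∣x∣² = begin
    proj₁ (coeffs k)            ≡⟨ cong ∣_∣ (sym (P-odd k)) ⟩
    ∣ P (+ (1 ℕ.+ k ℕ.* 2)) ∣   ≡⟨ cong (λ N′ → ∣ P (+ N′) ∣) (sym N≡1+2k) ⟩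
    ∣ P (+ N) ∣                 ≡⟨ cong ∣_∣ Pₙ≡x² ⟩
    ∣ x * x ∣                   ≡⟨ abs-* x x ⟩
    ∣ x ∣ ℕ.* ∣ x ∣             ∎

proposition1 : (n : ℤ) → ¬ (+ 2 ∣ n) → (x : ℤ) → P n ≡ x * x →
    (+ 840 ∣ (n - + 1)) ⊎ (+ 840 ∣ (n + + 1)) ⊎ (+ 840 ∣ (n - + 3)) ⊎ (+ 840 ∣ (n + + 3))
proposition1 (+ N)    2∤n x Pₙ≡x² = odd-square⇒Allowed N 2∤n x Pₙ≡x²
proposition1 -[1+ m ] 2∤n x Pₙ≡x² =
  Allowed-neg (+ suc m) (odd-square⇒Allowed (suc m) 2∤n x (trans (sym (P-neg (suc m))) Pₙ≡x²))
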